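{- Let $T$ be a tiling of a compact connected surface $S$ without boundary. The quadrilateral subdivision $T(4)$ of $T$ is (pentagonally) subdivisible if and only if $S$ is orientable.
   Context: A tiling of a compact connected surface without boundary is a graph embedded in the surface such that the complementary regions (tiles) are open disks; tilings are edge-to-edge, every vertex has degree at least $3$, every tile has at least $3$ edges, and tiles may be degenerate (boundary not a simple closed curve). Quadrilateral subdivision: given a tiling $T$, choose a middle point on each edge and a center point in each tile, and join the center of each tile to the middle point of each edge on the tile's boundary; the resulting quadrilateral tiling is $T(4)$. A simple pentagonal subdivision of a quadrilateral tiling is obtained by placing a new vertex at the middle point of every edge and, inside each quadrilateral tile, joining by an arc the middle points of one of the two pairs of opposite edges of the tile, such that the middle point of each edge is used exactly once. A quadrilateral tiling is (pentagonally) subdivisible if it admits a simple pentagonal subdivision. -}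

module Defs where

-- Combinatorial encoding of tilings of compact connected closed surfaces
-- by generalized maps (gems / flag systems).  A flag is a triangle
-- (vertex, edge-midpoint, tile-center) of the barycentric subdivision.
--   σ₀ : change the vertex, keep edge and tile
--   σ₁ : change the edge,   keep vertex and tile
--   σ₂ : change the tile,   keep vertex and edge
-- Vertices = ⟨σ₁,σ₂⟩-orbits, edges = ⟨σ₀,σ₂⟩-orbits, tiles = ⟨σ₀,σ₁⟩-orbits.
-- Every cellular embedding of a graph in a compact closed surface (tiles
-- open disks, degenerate tiles allowed) is described by such a finite gem,
-- and conversely; compactness = finitely many flags.

open import Data.Nat using (ℕ)
open import Data.Fin using (Fin; zero; suc)
open import Data.Bool using (Bool; not)
open import Data.Product using (_×_; _,_; Σ)
open import Relation.Binary.PropositionalEquality using (_≡_)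
open import Relation.Nullary using (¬_)

record Ops (F : Set) : Set where
  field
    σ₀ σ₁ σ₂ : F → F
open Ops public

data Step {F : Set} (O : Ops F) : F → F → Set where
  st₀ : ∀ f → Step O f (σ₀ O f)
  st₁ : ∀ f → Step O f (σ₁ O f)
  st₂ : ∀ f → Step O f (σ₂ O f)

data Reach {F : Set} (O : Ops F) : F → F → Set where
  here : ∀ {f} → Reach O f f
  step : ∀ {f g h} → Step O f g → Reach O g h → Reach O f h

record Tiling (n : ℕ) : Set where
  field
    ops : Ops (Fin n)
  field
    inv₀ : ∀ f → σ₀ ops (σ₀ ops f) ≡ f
    inv₁ : ∀ f → σ₁ ops (σ₁ ops f) ≡ f
    inv₂ : ∀ f → σ₂ ops (σ₂ ops f) ≡ f
    fpf₀ : ∀ f → ¬ σ₀ ops f ≡ f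
    fpf₁ : ∀ f → ¬ σ₁ ops f ≡ f
    fpf₂ : ∀ f → ¬ σ₂ ops f ≡ f
    -- σ₀σ₂ is a fixed-point-free involution (every edge has 4 flags)
    comm₀₂ : ∀ f → σ₀ ops (σ₂ ops f) ≡ σ₂ ops (σ₀ ops f)
    fpf₀₂  : ∀ f → ¬ σ₀ ops (σ₂ ops f) ≡ f
    connected : ∀ f g → Reach ops f g
    -- every vertex has degree ≥ 3: the rotation σ₂σ₁ around a vertex of
    -- degree d has period exactly d on each flag
    deg≥3  : ∀ f → ¬ σ₂ ops (σ₁ ops f) ≡ f × ¬ σ₂ ops (σ₁ ops (σ₂ ops (σ₁ ops f))) ≡ f
    -- every tile has ≥ 3 edges: the rotation σ₁σ₀ around a tile with k
    -- edges has period exactly k on each flag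
    size≥3 : ∀ f → ¬ σ₁ ops (σ₀ ops f) ≡ f × ¬ σ₁ ops (σ₀ ops (σ₁ ops (σ₀ ops f))) ≡ f

-- Orientability of the surface: the flags split into two classes
-- (the two local orientations) interchanged by every σᵢ.
Orientable : ∀ {n} → Tiling n → Set
Orientable {n} T = Σ (Fin n → Bool) λ c →
  (∀ f → c (σ₀ ops f) ≡ not (c f)) ×
  (∀ f → c (σ₁ ops f) ≡ not (c f)) ×
  (∀ f → c (σ₂ ops f) ≡ not (c f))
  where open Tiling T using (ops)

-- Quadrilateral subdivision T(4) as a flag system on Fin n × Fin 4.
-- A flag f = (v, m, c) of T is cut into four flags of T(4), using the
-- T(4)-tile center t on segment v–c, the T(4)-edge midpoint p on v–m
-- and the T(4)-edge midpoint q on m–c: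
--   0 = (v,p,t), 1 = (m,p,t), 2 = (m,q,t), 3 = (c,q,t).
module _ {n : ℕ} (T : Tiling n) where
  open Tiling T using (ops)
  private
    s₀ s₁ s₂ : Fin n → Fin n
    s₀ = σ₀ ops
    s₁ = σ₁ ops
    s₂ = σ₂ ops

  T4-σ₀ : Fin n × Fin 4 → Fin n × Fin 4
  T4-σ₀ (f , zero) = f , suc zero
  T4-σ₀ (f , suc zero) = f , zero
  T4-σ₀ (f , suc (suc zero)) = f , suc (suc (suc zero))
  T4-σ₀ (f , suc (suc (suc zero))) = f , suc (suc zero)

  T4-σ₁ : Fin n × Fin 4 → Fin n × Fin 4
  T4-σ₁ (f , zero) = s₁ f , zero
  T4-σ₁ (f , suc zero) = f , suc (suc zero)
  T4-σ₁ (f , suc (suc zero)) = f , suc zero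
  T4-σ₁ (f , suc (suc (suc zero))) = s₁ f , suc (suc (suc zero))

  T4-σ₂ : Fin n × Fin 4 → Fin n × Fin 4
  T4-σ₂ (f , zero) = s₂ f , zero
  T4-σ₂ (f , suc zero) = s₂ f , suc zero
  T4-σ₂ (f , suc (suc zero)) = s₀ f , suc (suc zero)
  T4-σ₂ (f , suc (suc (suc zero))) = s₀ f , suc (suc (suc zero))

  T4 : Ops (Fin n × Fin 4)
  T4 = record { σ₀ = T4-σ₀ ; σ₁ = T4-σ₁ ; σ₂ = T4-σ₂ }

-- Simple pentagonal subdivision of a quadrilateral tiling given by a flag
-- system O.  A "side" of a tile is a pair {f, σ₀ f} of flags (an edge as
-- it occurs on the boundary of that tile).  The selection c marks the
-- sides whose middle points are joined by the new arc inside the tile: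
--   * c is well defined on sides:            c (σ₀ f) = c f
--   * in each quadrilateral exactly one of the two pairs of opposite sides
--     is selected, i.e. consecutive sides alternate: c (σ₁ f) = not (c f)
--   * the middle point of every edge is used exactly once, i.e. of the two
--     sides {f,σ₀f}, {σ₂f,σ₀σ₂f} of each edge exactly one is selected:
--                                            c (σ₂ f) = not (c f)
Subdivisible : {F : Set} → Ops F → Set
Subdivisible {F} O = Σ (F → Bool) λ c →
  (∀ f → c (σ₀ O f) ≡ c f) ×
  (∀ f → c (σ₁ O f) ≡ not (c f)) ×
  (∀ f → c (σ₂ O f) ≡ not (c f))

module Submission where

-- Every flag f of T is cut into four flags (f , k), k = 0..3, of T(4);
-- corners 0,1 lie on the half of f next to the T-vertex, corners 2,3 on
-- the half next to the T-tile center.  The two directions are explicit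
-- translations between the two kinds of 2-colourings:
--   * A selection c on T(4) restricts to the orientation f ↦ c (f , 0).
--     σ₁ and σ₂ of T(4) act on corner 0 as σ₁ and σ₂ of T; for σ₀ we first
--     show c (f , 2) = not c (f , 0) (walk 0 →σ₀ 1 →σ₁ 2 inside f), and then
--     use that σ₂ of T(4) acts on corner 2 as σ₀ of T.
--   * An orientation o of T extends to the selection that equals o f on the
--     vertex half of f and not (o f) on the tile half; each defining
--     condition is then a direct check, corner by corner.

open import Defs
open import Data.Nat using (ℕ)
open import Data.Product using (_×_; _,_)
open import Data.Fin using (Fin; zero; suc)
open import Data.Bool using (Bool; true; false; not; if_then_else_)
open import Data.Bool.Properties using (not-involutive; not-injective)
open import Relation.Binary.PropositionalEquality using (_≡_; refl; sym; cong; module ≡-Reasoning)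
open ≡-Reasoning

nearVertex : Fin 4 → Bool
nearVertex zero                   = true
nearVertex (suc zero)             = true
nearVertex (suc (suc zero))       = false
nearVertex (suc (suc (suc zero))) = false

module _ {n : ℕ} (T : Tiling n) where
  open Tiling T using (ops)

  vertexCorner tileCorner : Fin n → Fin n × Fin 4
  vertexCorner f = f , zero
  tileCorner   f = f , suc (suc zero)

  -- A selection takes opposite values on the vertex and tile corners of
  -- each flag: (f , 0) and (f , 2) are joined by σ₁ ∘ σ₀ in T(4).
  selection-flips-across-flag : ∀ (c : Fin n × Fin 4 → Bool) →
    (∀ x → c (σ₀ (T4 T) x) ≡ c x) → (∀ x → c (σ₁ (T4 T) x) ≡ not (c x)) →
    ∀ f → c (tileCorner f) ≡ not (c (vertexCorner f))
  selection-flips-across-flag c c-σ₀ c-σ₁ f = begin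
    c (tileCorner f)              ≡⟨ c-σ₁ (f , suc zero) ⟩
    not (c (f , suc zero))        ≡⟨ cong not (c-σ₀ (vertexCorner f)) ⟩
    not (c (vertexCorner f))      ∎

  orientation-from-selection : Subdivisible (T4 T) → Orientable T
  orientation-from-selection (c , c-σ₀ , c-σ₁ , c-σ₂) =
    o , o-σ₀ , (λ f → c-σ₁ (vertexCorner f)) , (λ f → c-σ₂ (vertexCorner f))
    where
    o : Fin n → Bool
    o f = c (vertexCorner f)

    flip : ∀ f → c (tileCorner f) ≡ not (o f)
    flip = selection-flips-across-flag c c-σ₀ c-σ₁

    -- σ₂ of T(4) moves the tile corner of f to the tile corner of σ₀ f.
    o-σ₀ : ∀ f → o (σ₀ ops f) ≡ not (o f)
    o-σ₀ f = not-injective (begin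
      not (o (σ₀ ops f))          ≡⟨ sym (flip (σ₀ ops f)) ⟩
      c (tileCorner (σ₀ ops f))   ≡⟨ c-σ₂ (tileCorner f) ⟩
      not (c (tileCorner f))      ≡⟨ cong not (flip f) ⟩
      not (not (o f))             ∎)

  selection-from-orientation : Orientable T → Subdivisible (T4 T)
  selection-from-orientation (o , o-σ₀ , o-σ₁ , o-σ₂) = c , c-σ₀ , c-σ₁ , c-σ₂
    where
    c : Fin n × Fin 4 → Bool
    c (f , k) = if nearVertex k then o f else not (o f)

    c-σ₀ : ∀ x → c (σ₀ (T4 T) x) ≡ c x
    c-σ₀ (f , zero)                   = refl
    c-σ₀ (f , suc zero)               = refl
    c-σ₀ (f , suc (suc zero))         = refl
    c-σ₀ (f , suc (suc (suc zero)))   = refl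

    -- σ₁ of T(4) either crosses between the halves of f or acts as σ₁ of T.
    c-σ₁ : ∀ x → c (σ₁ (T4 T) x) ≡ not (c x)
    c-σ₁ (f , zero)                   = o-σ₁ f
    c-σ₁ (f , suc zero)               = refl
    c-σ₁ (f , suc (suc zero))         = sym (not-involutive (o f))
    c-σ₁ (f , suc (suc (suc zero)))   = cong not (o-σ₁ f)

    -- σ₂ of T(4) acts as σ₂ of T on the vertex half and as σ₀ of T on the
    -- tile half.
    c-σ₂ : ∀ x → c (σ₂ (T4 T) x) ≡ not (c x)
    c-σ₂ (f , zero)                   = o-σ₂ f
    c-σ₂ (f , suc zero)               = o-σ₂ f
    c-σ₂ (f , suc (suc zero))         = cong not (o-σ₀ f)
    c-σ₂ (f , suc (suc (suc zero)))   = cong not (o-σ₀ f)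

theorem3p6 : ∀ {n} (T : Tiling n) → (Subdivisible (T4 T) → Orientable T) × (Orientable T → Subdivisible (T4 T))
theorem3p6 T = orientation-from-selection T , selection-from-orientation T
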